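{- Let $G$ be a subgraph of a Cartesian product $\Gamma=G_1\square\cdots\square G_m$ of finite connected graphs, let $i\in\{1,\ldots,m\}$, $uv\in E(G_i)$, and let $G_{uv}$, $G^{uv}$, $G^{uv}_c$, $V_l(G^{uv})$ be as in the context. Then $$|V(G)|=|V(G_{uv})|+|V(G^{uv})|-|V_l(G^{uv})|=|V(G_{uv})|+|V(G^{uv}_c)|$$ and $$|E(G)|\le|E(G_{uv})|+|E(G^{uv})|+|V(G^{uv}_c)|.$$
   Context: All graphs finite, simple, undirected. The Cartesian product has vertex set $V(G_1)\times\cdots\times V(G_m)$, two tuples adjacent iff they differ in exactly one coordinate $j$ where they are adjacent in $G_j$. For a tuple $x$ and a vertex $a$, write $x[a]$ for the tuple obtained by replacing the $i$-th coordinate of $x$ by $a$. Let $N$ be the set of common neighbours of $u$ and $v$ in $G_i$. $\widehat G_i$ is obtained from $G_i$ by contracting $uv$ into a new vertex $w$ (no loops or multiple edges); $\widehat\Gamma$ is $\Gamma$ with $i$-th factor replaced by $\widehat G_i$; $\varphi$ maps a vertex of $\Gamma$ to $\widehat\Gamma$ by replacing the $i$-th coordinate by $w$ if it is $u$ or $v$; $G_{uv}$ is the subgraph of $\widehat\Gamma$ induced by $\varphi(V(G))$. $\widetilde G_i$ is the star with centre $\widetilde w$ and one leaf $\widetilde x$ for each $x\in N$; $\widetilde\Gamma$ is $\Gamma$ with $i$-th factor replaced by $\widetilde G_i$. $G^{uv}$ is the subgraph of $\widetilde\Gamma$ induced by the vertices $x[\widetilde w]$ such that $x[u],x[v]\in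 V(G)$, together with the vertices $x[\widetilde y]$ ($y\in N$) such that $x[y],x[u],x[v]\in V(G)$. $G^{uv}_c$ is the subgraph of $G^{uv}$ induced by its vertices with $i$-th coordinate $\widetilde w$, and $V_l(G^{uv})$ is the set of the remaining vertices of $G^{uv}$ (those with $i$-th coordinate a leaf $\widetilde y$). -}

module Defs where

open import Level using (0ℓ)
open import Data.Nat using (ℕ; suc; _+_; _∸_; ⌊_/2⌋)
open import Data.Nat.Properties using () renaming (_≟_ to _≟ℕ_)
open import Data.Fin using (Fin) renaming (_≟_ to _≟F_)
open import Data.Fin.Properties using (any?; all?)
open import Data.Vec using (Vec; []; _∷_; lookup; tabulate; _[_]≔_)
open import Data.Vec.Properties using (≡-dec)
open import Data.List using (List; []; _∷_; length; filter; concatMap; map; cartesianProduct)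
open import Data.Nat.ListAction using (sum)
open import Data.List.Membership.Propositional using (_∈_)
open import Data.List.Membership.DecPropositional _≟ℕ_ using (_∈?_)
open import Data.List.Relation.Unary.Unique.Propositional using (Unique)
open import Data.List.Relation.Unary.Any using (Any)
  renaming (any? to anyL?)
open import Data.Product using (Σ; ∃; _×_; _,_; proj₁; proj₂)
open import Data.Product.Properties using ()
open import Data.Sum using (_⊎_)
open import Data.Bool using (if_then_else_; _∨_)
open import Relation.Nullary using (¬_; Dec; does; ¬?)
open import Relation.Nullary.Decidable using (_×-dec_; _⊎-dec_; _→-dec_)
open import Relation.Unary using (Pred)
open import Relation.Binary using (Rel; Decidable)
open import Relation.Binary.PropositionalEquality using (_≡_; _≢_)

record Graph : Set₁ where
  field
    V        : List ℕ
    V-unique : Unique V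
    Adj      : ℕ → ℕ → Set
    Adj?     : Decidable Adj
    Adj-sym  : ∀ {x y} → Adj x y → Adj y x
    Adj-irr  : ∀ {x} → ¬ Adj x x
    Adj-V    : ∀ {x y} → Adj x y → x ∈ V
open Graph public

data Reach (G : Graph) : ℕ → ℕ → Set where
  here : ∀ {x} → Reach G x x
  step : ∀ {x y z} → Adj G x y → Reach G y z → Reach G x z

Connected : Graph → Set
Connected G = ∀ {x y} → x ∈ V G → y ∈ V G → Reach G x y

Tuple : ℕ → Set
Tuple m = Vec ℕ m

tuples : ∀ {m} → Vec (List ℕ) m → List (Tuple m)
tuples []         = [] ∷ []
tuples (L ∷ Ls)   = concatMap (λ a → map (a ∷_) (tuples Ls)) L

ProdAdj : ∀ {m} → (Fin m → ℕ → ℕ → Set) → Tuple m → Tuple m → Set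
ProdAdj {m} A x y =
  ∃ λ (j : Fin m) → A j (lookup x j) (lookup y j)
                   × (∀ k → k ≢ j → lookup x k ≡ lookup y k)

ProdAdj? : ∀ {m} (A : Fin m → ℕ → ℕ → Set) → (∀ j → Decidable (A j)) →
           Decidable (ProdAdj A)
ProdAdj? A A? x y = any? (λ j → A? j (lookup x j) (lookup y j)
  ×-dec all? (λ k → ¬? (k ≟F j) →-dec (lookup x k ≟ℕ lookup y k)))

module Product {m : ℕ} (Gs : Fin m → Graph) where

  Vs : Vec (List ℕ) m
  Vs = tabulate (λ j → V (Gs j))

  IsVertex : Tuple m → Set
  IsVertex x = ∀ j → lookup x j ∈ V (Gs j)

  ΓAdj : Tuple m → Tuple m → Set
  ΓAdj = ProdAdj (λ j → Adj (Gs j))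

  -- a (not necessarily induced) subgraph G of Γ
  record Subgraph : Set₁ where
    field
      VS      : Tuple m → Set
      VS?     : Relation.Unary.Decidable VS
      VS-Γ    : ∀ {x} → VS x → IsVertex x
      ES      : Tuple m → Tuple m → Set
      ES?     : Decidable ES
      ES-sym  : ∀ {x y} → ES x y → ES y x
      ES-V    : ∀ {x y} → ES x y → VS x × VS y
      ES-Γ    : ∀ {x y} → ES x y → ΓAdj x y
  open Subgraph public

-- Counting vertices / edges of a graph living inside a product whose
-- vertices are enumerated by a duplicate-free list `dom`.

countV : ∀ {m} (dom : List (Tuple m)) (P : Tuple m → Set) →
         Relation.Unary.Decidable P → ℕ
countV dom P P? = length (filter P? dom)

-- number of edges = (number of ordered adjacent pairs) / 2
countE : ∀ {m} (dom : List (Tuple m)) (E : Tuple m → Tuple m → Set) →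
         Decidable E → ℕ
countE dom E E? =
  ⌊ length (filter (λ p → E? (proj₁ p) (proj₂ p)) (cartesianProduct dom dom)) /2⌋

-- a label larger than every element of the list (hence fresh)
fresh : List ℕ → ℕ
fresh L = suc (sum L)

module Constructions {m : ℕ} (Gs : Fin m → Graph) (i : Fin m) (u v : ℕ) where
  open Product Gs

  Gi : Graph
  Gi = Gs i

  _[_] : Tuple m → ℕ → Tuple m
  x [ a ] = x [ i ]≔ a

  -- the new vertex w of Ĝ_i (also used as the centre w̃ of G̃_i)
  w : ℕ
  w = fresh (V Gi)

  Rest : ℕ → Set
  Rest y = y ∈ V Gi × y ≢ u × y ≢ v

  Rest? : Relation.Unary.Decidable Rest
  Rest? y = (y ∈? V Gi) ×-dec (¬? (y ≟ℕ u) ×-dec ¬? (y ≟ℕ v))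

  -- Ĝ_i : contract uv into w
  Vhat : List ℕ
  Vhat = w ∷ filter Rest? (V Gi)

  AdjHat : ℕ → ℕ → Set
  AdjHat x y =
      (x ≡ w × Rest y × (Adj Gi u y ⊎ Adj Gi v y))
    ⊎ (y ≡ w × Rest x × (Adj Gi u x ⊎ Adj Gi v x))
    ⊎ (Rest x × Rest y × Adj Gi x y)

  AdjHat? : Decidable AdjHat
  AdjHat? x y =
      ((x ≟ℕ w) ×-dec Rest? y ×-dec (Adj? Gi u y ⊎-dec Adj? Gi v y))
    ⊎-dec ((y ≟ℕ w) ×-dec Rest? x ×-dec (Adj? Gi u x ⊎-dec Adj? Gi v x))
    ⊎-dec (Rest? x ×-dec Rest? y ×-dec Adj? Gi x y)

  Nb : ℕ → Set
  Nb y = y ∈ V Gi × Adj Gi u y × Adj Gi v y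

  Nb? : Relation.Unary.Decidable Nb
  Nb? y = (y ∈? V Gi) ×-dec Adj? Gi u y ×-dec Adj? Gi v y

  -- G̃_i : star with centre w̃ = w and leaves ỹ = y for y ∈ N
  Vtil : List ℕ
  Vtil = w ∷ filter Nb? (V Gi)

  AdjTil : ℕ → ℕ → Set
  AdjTil x y = (x ≡ w × Nb y) ⊎ (y ≡ w × Nb x)

  AdjTil? : Decidable AdjTil
  AdjTil? x y = ((x ≟ℕ w) ×-dec Nb? y) ⊎-dec ((y ≟ℕ w) ×-dec Nb? x)

  Repl : (ℕ → ℕ → Set) → Fin m → ℕ → ℕ → Set
  Repl B j x y = (j ≡ i × B x y) ⊎ (j ≢ i × Adj (Gs j) x y)

  Repl? : (B : ℕ → ℕ → Set) → Decidable B → ∀ j → Decidable (Repl B j)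
  Repl? B B? j x y = ((j ≟F i) ×-dec B? x y) ⊎-dec (¬? (j ≟F i) ×-dec Adj? (Gs j) x y)

  domΓ domHat domTil : List (Tuple m)
  domΓ   = tuples Vs
  domHat = tuples (Vs [ i ]≔ Vhat)
  domTil = tuples (Vs [ i ]≔ Vtil)

  φ : Tuple m → Tuple m
  φ x = x [ i ]≔ (if does (lookup x i ≟ℕ u) ∨ does (lookup x i ≟ℕ v)
                   then w else lookup x i)

  module _ (G : Subgraph) where

    VGuv : Tuple m → Set
    VGuv y = Any (λ x → VS G x × φ x ≡ y) domΓ

    VGuv? : Relation.Unary.Decidable VGuv
    VGuv? y = anyL? (λ x → VS? G x ×-dec ≡-dec _≟ℕ_ (φ x) y) domΓ

    EGuv : Tuple m → Tuple m → Set
    EGuv y z = VGuv y × VGuv z × ProdAdj (Repl AdjHat) y z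

    EGuv? : Decidable EGuv
    EGuv? y z = VGuv? y ×-dec VGuv? z ×-dec ProdAdj? (Repl AdjHat) (Repl? AdjHat AdjHat?) y z

    VGup : Tuple m → Set
    VGup x =
        (lookup x i ≡ w × VS G (x [ u ]) × VS G (x [ v ]))
      ⊎ (Nb (lookup x i) × VS G (x [ lookup x i ]) × VS G (x [ u ]) × VS G (x [ v ]))

    VGup? : Relation.Unary.Decidable VGup
    VGup? x =
        ((lookup x i ≟ℕ w) ×-dec VS? G (x [ u ]) ×-dec VS? G (x [ v ]))
      ⊎-dec (Nb? (lookup x i) ×-dec VS? G (x [ lookup x i ]) ×-dec VS? G (x [ u ]) ×-dec VS? G (x [ v ]))

    EGup : Tuple m → Tuple m → Set
    EGup y z = VGup y × VGup z × ProdAdj (Repl AdjTil) y z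

    EGup? : Decidable EGup
    EGup? y z = VGup? y ×-dec VGup? z ×-dec ProdAdj? (Repl AdjTil) (Repl? AdjTil AdjTil?) y z

    VGc : Tuple m → Set
    VGc x = VGup x × lookup x i ≡ w

    VGc? : Relation.Unary.Decidable VGc
    VGc? x = VGup? x ×-dec (lookup x i ≟ℕ w)

    VGl : Tuple m → Set
    VGl x = VGup x × lookup x i ≢ w

    VGl? : Relation.Unary.Decidable VGl
    VGl? x = VGup? x ×-dec ¬? (lookup x i ≟ℕ w)

    |V[G]|  = countV domΓ (VS G) (VS? G)
    |E[G]|  = countE domΓ (ES G) (ES? G)
    |V[Guv]| = countV domHat VGuv VGuv?
    |E[Guv]| = countE domHat EGuv EGuv?
    |V[Gup]| = countV domTil VGup VGup?
    |E[Gup]| = countE domTil EGup EGup?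
    |V[Gc]|  = countV domTil VGc VGc?
    |Vl[Gup]| = countV domTil VGl VGl?

module Submission where

-- In the module Decomposition the vertices of G are sorted by their i-th
-- coordinate: those over u and over v correspond to the vertices of G_uv over
-- w (inclusion–exclusion, the overlap being G^uv_c), the others are fixed by
-- φ.  For edges, the ordered edges of G between the u- and v-layers inject
-- into G^uv_c via x ↦ x[w̃]; of the remaining ones, those with an end over v
-- whose u-copy still gives an edge are sent to G^uv by ψ (moving v to w̃), and
-- the rest are sent injectively to G_uv by φ.  Halving gives the edge bound.

open import Defs
open import Level using (0ℓ)
open import Function using (_∘_; id)
open import Data.Fin using (Fin; zero; suc) renaming (_≟_ to _≟F_)
open import Data.Vec using (Vec; []; _∷_; lookup; _[_]≔_)
open import Data.Vec.Properties
  using (∷-injective; tabulate∘lookup; tabulate-cong; lookup∘update; lookup∘update′; lookup∘tabulate; []≔-idempotent; []≔-lookup)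
open import Data.Nat using (ℕ; _+_; _∸_; _≤_; z≤n; s≤s; ⌊_/2⌋)
open import Data.Nat.Properties
open import Data.Nat.ListAction using (sum)
open import Data.List using (List; []; _∷_; _++_; map; filter; length; cartesianProduct; cartesianProductWith)
open import Data.List.Properties using (filter-++; filter-≐; length-++; length-removeAt′)
open import Data.List.Membership.Propositional using (_∈_; lose)
open import Data.List.Membership.Propositional.Properties
  using (∈-filter⁺; ∈-filter⁻; ∈-cartesianProductWith⁺; ∈-cartesianProductWith⁻; ∈-cartesianProduct⁺)
open import Data.List.Relation.Unary.Any using (here; there; index; _─_; satisfied)
import Data.List.Relation.Unary.All as All
open import Data.List.Relation.Unary.AllPairs using ([]; _∷_)
open import Data.List.Relation.Unary.Unique.Propositional using (Unique)
open import Data.List.Relation.Unary.Unique.Propositional.Properties using (filter⁺; cartesianProductWith⁺; cartesianProduct⁺)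
open import Data.Product using (∃; _×_; _,_; proj₁; proj₂)
open import Data.Sum using (_⊎_; inj₁; inj₂; [_,_]′)
open import Data.Empty using (⊥; ⊥-elim)
open import Relation.Nullary using (¬_; ¬?; Dec; yes; no; does)
open import Relation.Nullary.Decidable using (dec-true; dec-false; _×-dec_; _⊎-dec_)
open import Data.Bool using (true; false; if_then_else_; _∨_)
open import Relation.Unary using (Pred; Decidable; _∩_; ∁)
open import Relation.Unary.Properties using (_∩?_; ∁?)
open import Algebra.Properties.CommutativeSemigroup +-commutativeSemigroup using (interchange; xy∙z≈xz∙y)
import Relation.Binary as B
open import Data.Nat.Tactic.RingSolver using (solve-∀)
open import Relation.Binary.PropositionalEquality hiding ([_])

count : {A : Set} {P : Pred A 0ℓ} → Decidable P → List A → ℕ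
count P? xs = length (filter P? xs)

ind : {X : Set} → Dec X → ℕ
ind (yes _) = 1
ind (no _)  = 0

ind-no : {X : Set} (X? : Dec X) → ¬ X → ind X? ≡ 0
ind-no (yes x) ¬x = ⊥-elim (¬x x)
ind-no (no _)  _  = refl

module _ {A : Set} where
  open ≡-Reasoning


  count-∷ : {P : Pred A 0ℓ} (P? : Decidable P) (x : A) (xs : List A) →
            count P? (x ∷ xs) ≡ ind (P? x) + count P? xs
  count-∷ P? x xs with P? x
  ... | yes _ = refl
  ... | no _  = refl

  count-++ : {P : Pred A 0ℓ} (P? : Decidable P) (xs ys : List A) →
             count P? (xs ++ ys) ≡ count P? xs + count P? ys
  count-++ P? xs ys = trans (cong length (filter-++ P? xs ys)) (length-++ (filter P? xs))

  count-lift : {P Q R S : Pred A 0ℓ}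
    (P? : Decidable P) (Q? : Decidable Q) (R? : Decidable R) (S? : Decidable S) →
    (∀ x → ind (P? x) + ind (Q? x) ≡ ind (R? x) + ind (S? x)) →
    (xs : List A) → count P? xs + count Q? xs ≡ count R? xs + count S? xs
  count-lift P? Q? R? S? pointwise [] = refl
  count-lift P? Q? R? S? pointwise (x ∷ xs) = begin
    count P? (x ∷ xs) + count Q? (x ∷ xs)
      ≡⟨ cong₂ _+_ (count-∷ P? x xs) (count-∷ Q? x xs) ⟩
    (ind (P? x) + count P? xs) + (ind (Q? x) + count Q? xs)
      ≡⟨ interchange (ind (P? x)) (count P? xs) (ind (Q? x)) (count Q? xs) ⟩
    (ind (P? x) + ind (Q? x)) + (count P? xs + count Q? xs)
      ≡⟨ cong₂ _+_ (pointwise x) (count-lift P? Q? R? S? pointwise xs) ⟩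
    (ind (R? x) + ind (S? x)) + (count R? xs + count S? xs)
      ≡⟨ interchange (ind (R? x)) (ind (S? x)) (count R? xs) (count S? xs) ⟩
    (ind (R? x) + count R? xs) + (ind (S? x) + count S? xs)
      ≡⟨ cong₂ _+_ (count-∷ R? x xs) (count-∷ S? x xs) ⟨
    count R? (x ∷ xs) + count S? (x ∷ xs) ∎

  count-by : {P D : Pred A 0ℓ} (P? : Decidable P) (D? : Decidable D) (xs : List A) →
             count P? xs ≡ count (P? ∩? D?) xs + count (P? ∩? ∁? D?) xs
  count-by P? D? [] = refl
  count-by P? D? (x ∷ xs) = begin
    count P? (x ∷ xs)
      ≡⟨ count-∷ P? x xs ⟩
    ind (P? x) + count P? xs
      ≡⟨ cong₂ _+_ pointwise (count-by P? D? xs) ⟩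
    (ind ((P? ∩? D?) x) + ind ((P? ∩? ∁? D?) x)) + (count (P? ∩? D?) xs + count (P? ∩? ∁? D?) xs)
      ≡⟨ interchange (ind ((P? ∩? D?) x)) _ _ _ ⟩
    (ind ((P? ∩? D?) x) + count (P? ∩? D?) xs) + (ind ((P? ∩? ∁? D?) x) + count (P? ∩? ∁? D?) xs)
      ≡⟨ cong₂ _+_ (count-∷ (P? ∩? D?) x xs) (count-∷ (P? ∩? ∁? D?) x xs) ⟨
    count (P? ∩? D?) (x ∷ xs) + count (P? ∩? ∁? D?) (x ∷ xs) ∎
    where
    pointwise : ind (P? x) ≡ ind ((P? ∩? D?) x) + ind ((P? ∩? ∁? D?) x)
    pointwise with P? x | D? x
    ... | yes _ | yes _ = refl
    ... | yes _ | no _  = refl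
    ... | no _  | yes _ = refl
    ... | no _  | no _  = refl

  count-union : {P Q U I : Pred A 0ℓ}
    (P? : Decidable P) (Q? : Decidable Q) (U? : Decidable U) (I? : Decidable I) →
    (∀ {x} → U x → P x ⊎ Q x) → (∀ {x} → P x → U x) → (∀ {x} → Q x → U x) →
    (∀ {x} → I x → P x × Q x) → (∀ {x} → P x → Q x → I x) →
    (xs : List A) → count P? xs + count Q? xs ≡ count U? xs + count I? xs
  count-union P? Q? U? I? cover inP inQ meet both = count-lift P? Q? U? I? pointwise
    where
    pointwise : ∀ x → ind (P? x) + ind (Q? x) ≡ ind (U? x) + ind (I? x)
    pointwise x with P? x | Q? x | U? x | I? x
    ... | yes _ | yes _ | yes _ | yes _ = refl
    ... | yes p | yes q | _     | no ¬i = ⊥-elim (¬i (both p q))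
    ... | yes p | _     | no ¬u | _     = ⊥-elim (¬u (inP p))
    ... | _     | yes q | no ¬u | _     = ⊥-elim (¬u (inQ q))
    ... | no ¬p | _     | _     | yes i = ⊥-elim (¬p (proj₁ (meet i)))
    ... | _     | no ¬q | _     | yes i = ⊥-elim (¬q (proj₂ (meet i)))
    ... | yes _ | no _  | yes _ | no _  = refl
    ... | no _  | yes _ | yes _ | no _  = refl
    ... | no ¬p | no ¬q | yes u | no _  = ⊥-elim ([ ¬p , ¬q ]′ (cover u))
    ... | no _  | no _  | no _  | no _  = refl

module _ {A C : Set} where

  ∈-─ : {x y : C} {zs : List C} (x∈zs : x ∈ zs) → y ∈ zs → y ≢ x → y ∈ (zs ─ x∈zs)
  ∈-─ (here refl) (here refl) y≢x = ⊥-elim (y≢x refl)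
  ∈-─ (here refl) (there y∈zs) _ = y∈zs
  ∈-─ (there x∈zs) (here refl) _ = here refl
  ∈-─ (there x∈zs) (there y∈zs) y≢x = there (∈-─ x∈zs y∈zs y≢x)

  unique-injection : (xs : List A) (zs : List C) (f : A → C) → Unique xs →
    (∀ {x} → x ∈ xs → f x ∈ zs) →
    (∀ {x y} → x ∈ xs → y ∈ xs → f x ≡ f y → x ≡ y) →
    length xs ≤ length zs
  unique-injection [] zs f _ _ _ = z≤n
  unique-injection (x ∷ xs) zs f (x∉xs ∷ uniq) into inj =
    ≤-trans (s≤s (unique-injection xs (zs ─ fx∈zs) f uniq into′ inj′))
            (≤-reflexive (sym (length-removeAt′ zs (index fx∈zs))))
    where
    fx∈zs = into (here refl)
    into′ : ∀ {y} → y ∈ xs → f y ∈ (zs ─ fx∈zs)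
    into′ y∈xs = ∈-─ fx∈zs (into (there y∈xs))
      (λ fy≡fx → All.lookup x∉xs y∈xs (sym (inj (there y∈xs) (here refl) fy≡fx)))
    inj′ : ∀ {y z} → y ∈ xs → z ∈ xs → f y ≡ f z → y ≡ z
    inj′ y∈xs z∈xs = inj (there y∈xs) (there z∈xs)

  count-injection : {P : Pred A 0ℓ} {Q : Pred C 0ℓ} (P? : Decidable P) (Q? : Decidable Q)
    (xs : List A) (zs : List C) (f : A → C) → Unique xs →
    (∀ {x} → x ∈ xs → P x → f x ∈ zs × Q (f x)) →
    (∀ {x y} → x ∈ xs → y ∈ xs → P x → P y → f x ≡ f y → x ≡ y) →
    count P? xs ≤ count Q? zs
  count-injection P? Q? xs zs f uniq into inj =
    unique-injection (filter P? xs) (filter Q? zs) f (filter⁺ P? uniq) into′ inj′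
    where
    into′ : ∀ {x} → x ∈ filter P? xs → f x ∈ filter Q? zs
    into′ x∈ with ∈-filter⁻ P? x∈
    ... | x∈xs , px = ∈-filter⁺ Q? (proj₁ (into x∈xs px)) (proj₂ (into x∈xs px))
    inj′ : ∀ {x y} → x ∈ filter P? xs → y ∈ filter P? xs → f x ≡ f y → x ≡ y
    inj′ x∈ y∈ with ∈-filter⁻ P? x∈ | ∈-filter⁻ P? y∈
    ... | x∈xs , px | y∈xs , py = inj x∈xs y∈xs px py

count-bijection : {A C : Set} {P : Pred A 0ℓ} {Q : Pred C 0ℓ} (P? : Decidable P) (Q? : Decidable Q)
  (xs : List A) (zs : List C) (f : A → C) (g : C → A) → Unique xs → Unique zs →
  (∀ {x} → x ∈ xs → P x → f x ∈ zs × Q (f x)) →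
  (∀ {x y} → x ∈ xs → y ∈ xs → P x → P y → f x ≡ f y → x ≡ y) →
  (∀ {z} → z ∈ zs → Q z → g z ∈ xs × P (g z)) →
  (∀ {z z′} → z ∈ zs → z′ ∈ zs → Q z → Q z′ → g z ≡ g z′ → z ≡ z′) →
  count P? xs ≡ count Q? zs
count-bijection P? Q? xs zs f g uniq-xs uniq-zs into-f inj-f into-g inj-g = ≤-antisym
  (count-injection P? Q? xs zs f uniq-xs into-f inj-f)
  (count-injection Q? P? zs xs g uniq-zs into-g inj-g)

module OrderedPairs {A : Set} {R : A → A → Set} (R? : B.Decidable R) where
  open ≡-Reasoning


  Related : Pred (A × A) 0ℓ
  Related p = R (proj₁ p) (proj₂ p)

  Related? : Decidable Related
  Related? p = R? (proj₁ p) (proj₂ p)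

  pairs : List A → List A → ℕ
  pairs xs ys = count Related? (cartesianProduct xs ys)

  pairs-row : (x : A) (ys : List A) → count Related? (map (x ,_) ys) ≡ count (R? x) ys
  pairs-row x [] = refl
  pairs-row x (y ∷ ys) = begin
    count Related? (map (x ,_) (y ∷ ys))      ≡⟨ count-∷ Related? (x , y) (map (x ,_) ys) ⟩
    ind (R? x y) + count Related? (map (x ,_) ys) ≡⟨ cong (ind (R? x y) +_) (pairs-row x ys) ⟩
    ind (R? x y) + count (R? x) ys             ≡⟨ count-∷ (R? x) y ys ⟨
    count (R? x) (y ∷ ys)                     ∎

  pairs-∷ˡ : (x : A) (xs ys : List A) → pairs (x ∷ xs) ys ≡ count (R? x) ys + pairs xs ys
  pairs-∷ˡ x xs ys = begin
    pairs (x ∷ xs) ys                                           ≡⟨ count-++ Related? (map (x ,_) ys) _ ⟩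
    count Related? (map (x ,_) ys) + pairs xs ys                ≡⟨ cong (_+ pairs xs ys) (pairs-row x ys) ⟩
    count (R? x) ys + pairs xs ys                               ∎

  pairs-∷ʳ : (xs : List A) (y : A) (ys : List A) →
             pairs xs (y ∷ ys) ≡ count (λ x → R? x y) xs + pairs xs ys
  pairs-∷ʳ [] y ys = refl
  pairs-∷ʳ (x ∷ xs) y ys = begin
    pairs (x ∷ xs) (y ∷ ys)
      ≡⟨ pairs-∷ˡ x xs (y ∷ ys) ⟩
    count (R? x) (y ∷ ys) + pairs xs (y ∷ ys)
      ≡⟨ cong₂ _+_ (count-∷ (R? x) y ys) (pairs-∷ʳ xs y ys) ⟩
    (ind (R? x y) + count (R? x) ys) + (count (λ z → R? z y) xs + pairs xs ys)
      ≡⟨ interchange (ind (R? x y)) _ _ (pairs xs ys) ⟩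
    (ind (R? x y) + count (λ z → R? z y) xs) + (count (R? x) ys + pairs xs ys)
      ≡⟨ cong₂ _+_ (count-∷ (λ z → R? z y) x xs) (pairs-∷ˡ x xs ys) ⟨
    count (λ z → R? z y) (x ∷ xs) + pairs (x ∷ xs) ys ∎

  -- A symmetric irreflexive relation relates an even number of ordered pairs:
  -- the pairs (x , y) and (y , x) come in distinct couples.
  pairs-even : (∀ {x y} → R x y → R y x) → (∀ {x} → ¬ R x x) →
               (xs : List A) → ∃ λ k → pairs xs xs ≡ k + k
  pairs-even sym-R irr-R [] = 0 , refl
  pairs-even sym-R irr-R (x ∷ xs) with pairs-even sym-R irr-R xs
  ... | k , pairs≡k+k = row + k , (begin
    pairs (x ∷ xs) (x ∷ xs)
      ≡⟨ pairs-∷ˡ x xs (x ∷ xs) ⟩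
    count (R? x) (x ∷ xs) + pairs xs (x ∷ xs)
      ≡⟨ cong₂ _+_ (count-∷ (R? x) x xs) (pairs-∷ʳ xs x xs) ⟩
    (ind (R? x x) + row) + (count (λ z → R? z x) xs + pairs xs xs)
      ≡⟨ cong₂ (λ a b → (a + row) + (b + pairs xs xs)) (ind-no (R? x x) irr-R) column≡row ⟩
    row + (row + pairs xs xs)
      ≡⟨ cong (λ n → row + (row + n)) pairs≡k+k ⟩
    row + (row + (k + k))
      ≡⟨ +-assoc row row (k + k) ⟨
    (row + row) + (k + k)
      ≡⟨ interchange row k row k ⟨
    (row + k) + (row + k) ∎)
    where
    row = count (R? x) xs
    column≡row : count (λ z → R? z x) xs ≡ row
    column≡row = cong length (filter-≐ (λ z → R? z x) (R? x) (sym-R , sym-R) xs)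

  pairs≡edges+edges : (∀ {x y} → R x y → R y x) → (∀ {x} → ¬ R x x) → (xs : List A) →
                      pairs xs xs ≡ ⌊ pairs xs xs /2⌋ + ⌊ pairs xs xs /2⌋
  pairs≡edges+edges sym-R irr-R xs with pairs-even sym-R irr-R xs
  ... | k , pairs≡k+k = begin
    pairs xs xs                         ≡⟨ pairs≡k+k ⟩
    k + k                               ≡⟨ cong₂ _+_ half half ⟩
    ⌊ pairs xs xs /2⌋ + ⌊ pairs xs xs /2⌋ ∎
    where
    half : k ≡ ⌊ pairs xs xs /2⌋
    half = trans (n≡⌊n+n/2⌋ k) (cong ⌊_/2⌋ (sym pairs≡k+k))

half-≤ : ∀ {n} a b c → n ≤ (a + a) + (b + b) + (c + c) → ⌊ n /2⌋ ≤ a + b + c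
half-≤ {n} a b c n≤ = begin
  ⌊ n /2⌋                                    ≤⟨ ⌊n/2⌋-mono n≤ ⟩
  ⌊ (a + a) + (b + b) + (c + c) /2⌋          ≡⟨ cong ⌊_/2⌋ (regroup a b c) ⟩
  ⌊ (a + b + c) + (a + b + c) /2⌋            ≡⟨ n≡⌊n+n/2⌋ (a + b + c) ⟨
  a + b + c                                  ∎
  where
  open ≤-Reasoning
  regroup : ∀ a b c → (a + a) + (b + b) + (c + c) ≡ (a + b + c) + (a + b + c)
  regroup = solve-∀

tuples-∷ : ∀ {n} (L : List ℕ) (Ls : Vec (List ℕ) n) →
           tuples (L ∷ Ls) ≡ cartesianProductWith _∷_ L (tuples Ls)
tuples-∷ [] Ls = refl
tuples-∷ (a ∷ L) Ls = cong (map (a ∷_) (tuples Ls) ++_) (tuples-∷ L Ls)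

tuples⁺ : ∀ {n} (Ls : Vec (List ℕ) n) (x : Tuple n) →
          (∀ j → lookup x j ∈ lookup Ls j) → x ∈ tuples Ls
tuples⁺ [] [] _ = here refl
tuples⁺ (L ∷ Ls) (a ∷ x) coords rewrite tuples-∷ L Ls =
  ∈-cartesianProductWith⁺ _∷_ (coords zero) (tuples⁺ Ls x (coords ∘ suc))

tuples⁻ : ∀ {n} (Ls : Vec (List ℕ) n) (x : Tuple n) →
          x ∈ tuples Ls → ∀ j → lookup x j ∈ lookup Ls j
tuples⁻ (L ∷ Ls) (a ∷ x) x∈ j rewrite tuples-∷ L Ls
  with ∈-cartesianProductWith⁻ _∷_ L (tuples Ls) x∈
tuples⁻ (L ∷ Ls) (a ∷ x) x∈ zero    | _ , _ , a∈L , _ , refl = a∈L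
tuples⁻ (L ∷ Ls) (a ∷ x) x∈ (suc j) | _ , _ , _ , x∈Ls , refl = tuples⁻ Ls x x∈Ls j

tuples-unique : ∀ {n} (Ls : Vec (List ℕ) n) →
                (∀ j → Unique (lookup Ls j)) → Unique (tuples Ls)
tuples-unique [] _ = All.[] ∷ []
tuples-unique (L ∷ Ls) uniq rewrite tuples-∷ L Ls =
  cartesianProductWith⁺ _∷_ ∷-injective (uniq zero) (tuples-unique Ls (uniq ∘ suc))

vec-ext : {A : Set} {n : ℕ} {x y : Vec A n} → (∀ k → lookup x k ≡ lookup y k) → x ≡ y
vec-ext {x = x} {y} same = trans (sym (tabulate∘lookup x))
                                 (trans (tabulate-cong same) (tabulate∘lookup y))

module Replace {A : Set} {n : ℕ} (i : Fin n) where

  _[_] : Vec A n → A → Vec A n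
  x [ a ] = x [ i ]≔ a

  Agree : Vec A n → Vec A n → Set
  Agree x y = ∀ k → k ≢ i → lookup x k ≡ lookup y k

  agree-sym : ∀ {x y} → Agree x y → Agree y x
  agree-sym x≈y k k≢i = sym (x≈y k k≢i)

  lookup-at : ∀ x a → lookup (x [ a ]) i ≡ a
  lookup-at x a = lookup∘update i x a

  lookup-off : ∀ x a {k} → k ≢ i → lookup (x [ a ]) k ≡ lookup x k
  lookup-off x a k≢i = lookup∘update′ k≢i x a

  agree-replaced : ∀ x a → Agree (x [ a ]) x
  agree-replaced x a k k≢i = lookup-off x a k≢i

  agree-≡ : ∀ {x y} → Agree x y → lookup x i ≡ lookup y i → x ≡ y
  agree-≡ {x} {y} x≈y xi≡yi = vec-ext same
    where
    same : ∀ k → lookup x k ≡ lookup y k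
    same k with k ≟F i
    ... | yes refl = xi≡yi
    ... | no k≢i   = x≈y k k≢i

  agree-replace : ∀ {x y} → Agree x y → ∀ a → x [ a ] ≡ y [ a ]
  agree-replace {x} {y} x≈y a = agree-≡
    (λ k k≢i → trans (lookup-off x a k≢i) (trans (x≈y k k≢i) (sym (lookup-off y a k≢i))))
    (trans (lookup-at x a) (sym (lookup-at y a)))

  agree-at : ∀ {x y a} → Agree x y → lookup y i ≡ a → y ≡ x [ a ]
  agree-at {x} {y} {a} x≈y yi≡a =
    agree-≡ (λ k k≢i → trans (sym (x≈y k k≢i)) (sym (lookup-off x a k≢i)))
            (trans yi≡a (sym (lookup-at x a)))

  replace-replace : ∀ x a b → (x [ a ]) [ b ] ≡ x [ b ]
  replace-replace x a b = []≔-idempotent x i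

  replace-self : ∀ x {a} → lookup x i ≡ a → x [ a ] ≡ x
  replace-self x refl = []≔-lookup x i

  replace-restore : ∀ x a {b} → lookup x i ≡ b → (x [ a ]) [ b ] ≡ x
  replace-restore x a xi≡b = trans (replace-replace x a _) (replace-self x xi≡b)

  replace-back : ∀ {x y a b} → lookup x i ≡ a → x [ b ] ≡ y → x ≡ y [ a ]
  replace-back {x} {b = b} xi≡a x[b]≡y = trans (sym (replace-restore x b xi≡a)) (cong (_[ _ ]) x[b]≡y)

  replace-injective : ∀ {x y a b} → lookup x i ≡ b → lookup y i ≡ b → x [ a ] ≡ y [ a ] → x ≡ y
  replace-injective {x} {y} {a} {b} xi≡b yi≡b xa≡ya = begin
    x               ≡⟨ replace-restore x a xi≡b ⟨
    (x [ a ]) [ b ] ≡⟨ cong (_[ b ]) xa≡ya ⟩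
    (y [ a ]) [ b ] ≡⟨ replace-restore y a yi≡b ⟩
    y               ∎
    where open ≡-Reasoning

fresh-∉ : ∀ {a} (L : List ℕ) → a ∈ L → a ≢ fresh L
fresh-∉ L a∈L = <⇒≢ (s≤s (∈⇒≤sum L a∈L))
  where
  ∈⇒≤sum : ∀ {a} (L : List ℕ) → a ∈ L → a ≤ sum L
  ∈⇒≤sum (b ∷ L) (here refl) = m≤m+n b (sum L)
  ∈⇒≤sum (b ∷ L) (there a∈L) = ≤-trans (∈⇒≤sum L a∈L) (m≤n+m (sum L) b)

module ProductEdges {m : ℕ} (A : Fin m → ℕ → ℕ → Set) (i : Fin m) where
  open Replace {ℕ} i

  edge-at : ∀ {x y} → ProdAdj A x y → lookup x i ≢ lookup y i →
            Agree x y × A i (lookup x i) (lookup y i)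
  edge-at (j , a , same) xi≢yi with j ≟F i
  ... | yes refl = same , a
  ... | no j≢i   = ⊥-elim (xi≢yi (same i (λ i≡j → j≢i (sym i≡j))))

  edge-off : (∀ {a} → ¬ A i a a) → ∀ {x y} → ProdAdj A x y → lookup x i ≡ lookup y i →
             ∃ λ j → j ≢ i × A j (lookup x j) (lookup y j) × (∀ k → k ≢ j → lookup x k ≡ lookup y k)
  edge-off irr (j , a , same) xi≡yi with j ≟F i
  ... | yes refl = ⊥-elim (irr (subst (A i _) (sym xi≡yi) a))
  ... | no j≢i   = j , j≢i , a , same

module _ {m : ℕ} {A : Fin m → ℕ → ℕ → Set} where

  prodAdj-sym : (∀ j {a b} → A j a b → A j b a) → ∀ {x y} → ProdAdj A x y → ProdAdj A y x
  prodAdj-sym sym-A (j , a , same) = j , sym-A j a , λ k k≢j → sym (same k k≢j)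

  prodAdj-irr : (∀ j {a} → ¬ A j a a) → ∀ {x} → ¬ ProdAdj A x x
  prodAdj-irr irr-A (j , a , _) = irr-A j a

module Decomposition {m : ℕ} (Gs : Fin m → Graph) (G : Product.Subgraph Gs)
                     (i : Fin m) (u v : ℕ) (uv : Adj (Gs i) u v) where
  open Product Gs
  open Constructions Gs i u v
  open Replace {ℕ} i hiding (_[_])
  open ProductEdges (λ j → Adj (Gs j)) i

  u≢v : u ≢ v
  u≢v u≡v = Adj-irr Gi (subst (Adj Gi u) (sym u≡v) uv)

  w-fresh : ∀ {a} → a ∈ V Gi → a ≢ w
  w-fresh = fresh-∉ (V Gi)

  coord∈Gᵢ : ∀ {x} → VS G x → lookup x i ∈ V Gi
  coord∈Gᵢ x∈G = VS-Γ G x∈G i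

  domain : List ℕ → List (Tuple m)
  domain L = tuples (Vs [ i ]≔ L)

  Vs-at : ∀ j → lookup Vs j ≡ V (Gs j)
  Vs-at j = lookup∘tabulate (λ j → V (Gs j)) j

  factor-i : ∀ L → lookup (Vs [ i ]≔ L) i ≡ L
  factor-i L = lookup∘update i Vs L

  factor-off : ∀ L {j} → j ≢ i → lookup (Vs [ i ]≔ L) j ≡ V (Gs j)
  factor-off L j≢i = trans (lookup∘update′ j≢i Vs L) (Vs-at _)

  ∈-domain : ∀ L {x} → lookup x i ∈ L → (∀ j → j ≢ i → lookup x j ∈ V (Gs j)) → x ∈ domain L
  ∈-domain L {x} xi∈L off = tuples⁺ (Vs [ i ]≔ L) x coords
    where
    coords : ∀ j → lookup x j ∈ lookup (Vs [ i ]≔ L) j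
    coords j with j ≟F i
    ... | yes refl = subst (lookup x i ∈_) (sym (factor-i L)) xi∈L
    ... | no j≢i   = subst (lookup x j ∈_) (sym (factor-off L j≢i)) (off j j≢i)

  domain-off : ∀ L {x} → x ∈ domain L → ∀ j → j ≢ i → lookup x j ∈ V (Gs j)
  domain-off L {x} x∈ j j≢i = subst (lookup x j ∈_) (factor-off L j≢i) (tuples⁻ (Vs [ i ]≔ L) x x∈ j)

  domain-unique : ∀ L → Unique L → Unique (domain L)
  domain-unique L uniq = tuples-unique (Vs [ i ]≔ L) factors
    where
    factors : ∀ j → Unique (lookup (Vs [ i ]≔ L) j)
    factors j with j ≟F i
    ... | yes refl = subst Unique (sym (factor-i L)) uniq
    ... | no j≢i   = subst Unique (sym (factor-off L j≢i)) (V-unique (Gs j))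

  replace-∈-domain : ∀ L {x a} → IsVertex x → a ∈ L → x [ a ] ∈ domain L
  replace-∈-domain L {x} {a} x∈Γ a∈L = ∈-domain L (subst (_∈ L) (sym (lookup-at x a)) a∈L)
    (λ j j≢i → subst (_∈ V (Gs j)) (sym (lookup-off x a j≢i)) (x∈Γ j))

  change-domain : ∀ L L′ {x} → x ∈ domain L → lookup x i ∈ L′ → x ∈ domain L′
  change-domain L L′ x∈ xi∈L′ = ∈-domain L′ xi∈L′ (domain-off L x∈)

  ∈Γ : ∀ {x} → VS G x → x ∈ domΓ
  ∈Γ {x} x∈G = tuples⁺ Vs x (λ j → subst (lookup x j ∈_) (sym (Vs-at j)) (VS-Γ G x∈G j))

  Γ-unique : Unique domΓ
  Γ-unique = tuples-unique Vs (λ j → subst Unique (sym (Vs-at j)) (V-unique (Gs j)))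

  w∷-unique : ∀ {P : Pred ℕ 0ℓ} (P? : Decidable P) → Unique (w ∷ filter P? (V Gi))
  w∷-unique P? = All.tabulate (λ y∈ w≡y → w-fresh (proj₁ (∈-filter⁻ P? y∈)) (sym w≡y))
               ∷ filter⁺ P? (V-unique Gi)

  rest∈Ĝᵢ : ∀ {a} → Rest a → a ∈ Vhat
  rest∈Ĝᵢ r = there (∈-filter⁺ Rest? (proj₁ r) r)

  nb∈G̃ᵢ : ∀ {a} → Nb a → a ∈ Vtil
  nb∈G̃ᵢ nb = there (∈-filter⁺ Nb? (proj₁ nb) nb)

  classify : ∀ {a} → a ∈ V Gi → a ≡ u ⊎ a ≡ v ⊎ Rest a
  classify {a} a∈Gᵢ with a ≟ u | a ≟ v
  ... | yes a≡u | _       = inj₁ a≡u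
  ... | no _    | yes a≡v = inj₂ (inj₁ a≡v)
  ... | no a≢u  | no a≢v  = inj₂ (inj₂ (a∈Gᵢ , a≢u , a≢v))

  Γ̂-unique : Unique domHat
  Γ̂-unique = domain-unique Vhat (w∷-unique Rest?)

  Γ̃-unique : Unique domTil
  Γ̃-unique = domain-unique Vtil (w∷-unique Nb?)

  contract : ℕ → ℕ
  contract a = if does (a ≟ u) ∨ does (a ≟ v) then w else a

  contract-u : ∀ {a} → a ≡ u → contract a ≡ w
  contract-u {a} a≡u rewrite dec-true (a ≟ u) a≡u = refl

  contract-v : ∀ {a} → a ≡ v → contract a ≡ w
  contract-v {a} a≡v with does (a ≟ u)
  ... | true  = refl
  ... | false rewrite dec-true (a ≟ v) a≡v = refl

  contract-rest : ∀ {a} → a ≢ u → a ≢ v → contract a ≡ a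
  contract-rest {a} a≢u a≢v rewrite dec-false (a ≟ u) a≢u | dec-false (a ≟ v) a≢v = refl

  φ-at : ∀ x → lookup (φ x) i ≡ contract (lookup x i)
  φ-at x = lookup-at x (contract (lookup x i))

  φ-off : ∀ x {k} → k ≢ i → lookup (φ x) k ≡ lookup x k
  φ-off x = lookup-off x (contract (lookup x i))

  φ-u : ∀ x → lookup x i ≡ u → φ x ≡ x [ w ]
  φ-u x xi≡u = cong (x [_]) (contract-u xi≡u)

  φ-v : ∀ x → lookup x i ≡ v → φ x ≡ x [ w ]
  φ-v x xi≡v = cong (x [_]) (contract-v xi≡v)

  φ-rest : ∀ x → lookup x i ≢ u → lookup x i ≢ v → φ x ≡ x
  φ-rest x xi≢u xi≢v = trans (cong (x [_]) (contract-rest xi≢u xi≢v)) (replace-self x refl)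

  contract-∈Ĝᵢ : ∀ {a} → a ∈ V Gi → contract a ∈ Vhat
  contract-∈Ĝᵢ a∈Gᵢ with classify a∈Gᵢ
  ... | inj₁ a≡u        = subst (_∈ Vhat) (sym (contract-u a≡u)) (here refl)
  ... | inj₂ (inj₁ a≡v) = subst (_∈ Vhat) (sym (contract-v a≡v)) (here refl)
  ... | inj₂ (inj₂ r@(_ , a≢u , a≢v)) = subst (_∈ Vhat) (sym (contract-rest a≢u a≢v)) (rest∈Ĝᵢ r)

  φ-∈Γ̂ : ∀ {x} → VS G x → φ x ∈ domHat
  φ-∈Γ̂ x∈G = replace-∈-domain Vhat (VS-Γ G x∈G) (contract-∈Ĝᵢ (coord∈Gᵢ x∈G))

  At : ℕ → Pred (Tuple m) 0ℓ
  At a x = lookup x i ≡ a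

  at? : ∀ a → Decidable (At a)
  at? a x = lookup x i ≟ a

  Over : ℕ → Pred (Tuple m) 0ℓ
  Over a = VS G ∩ At a

  Lift : ℕ → Pred (Tuple m) 0ℓ
  Lift a y = At w y × VS G (y [ a ])

  lift? : ∀ a → Decidable (Lift a)
  lift? a = at? w ∩? (λ y → VS? G (y [ a ]))

  -- x ↦ x[w] and y ↦ y[a] are inverse bijections between them.
  |over|≡|lift| : ∀ {P : Pred (Tuple m) 0ℓ} (P? : Decidable P) a →
    (∀ {x} → Over a x → P x) → (∀ {x} → P x → Over a x) →
    count P? domΓ ≡ count (lift? a) domHat
  |over|≡|lift| {P} P? a over→P P→over = count-bijection P? (lift? a) domΓ domHat (_[ w ]) (_[ a ])
    Γ-unique Γ̂-unique to-lift
    (λ _ _ px py → replace-injective (proj₂ (P→over px)) (proj₂ (P→over py)))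
    to-over
    (λ _ _ (yw , _) (y′w , _) → replace-injective yw y′w)
    where
    to-lift : ∀ {x} → x ∈ domΓ → P x → x [ w ] ∈ domHat × Lift a (x [ w ])
    to-lift {x} _ px with P→over px
    ... | x∈G , xi≡a = replace-∈-domain Vhat (VS-Γ G x∈G) (here refl) , lookup-at x w ,
      subst (VS G) (sym (replace-restore x w xi≡a)) x∈G
    to-over : ∀ {y} → y ∈ domHat → Lift a y → y [ a ] ∈ domΓ × P (y [ a ])
    to-over {y} _ (_ , ya∈G) = ∈Γ ya∈G , over→P (ya∈G , lookup-at y a)

  φ-∈Guv : ∀ {x} → VS G x → VGuv G (φ x)
  φ-∈Guv x∈G = lose (∈Γ x∈G) (x∈G , refl)

  -- Vertices of G off u and v are untouched by φ; they are the vertices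
  -- of G_uv off w.
  |off-uv|≡|Guv-off-w| : count ((VS? G ∩? ∁? (at? u)) ∩? ∁? (at? v)) domΓ
                       ≡ count (VGuv? G ∩? ∁? (at? w)) domHat
  |off-uv|≡|Guv-off-w| = count-bijection _ _ domΓ domHat id id Γ-unique Γ̂-unique
    to-Guv (λ _ _ _ _ → id) to-G (λ _ _ _ _ → id)
    where
    to-Guv : ∀ {x} → x ∈ domΓ → ((VS G ∩ ∁ (At u)) ∩ ∁ (At v)) x → x ∈ domHat × (VGuv G ∩ ∁ (At w)) x
    to-Guv {x} _ ((x∈G , xi≢u) , xi≢v) =
      ∈-domain Vhat (rest∈Ĝᵢ (coord∈Gᵢ x∈G , xi≢u , xi≢v)) (λ j _ → VS-Γ G x∈G j) ,
      subst (VGuv G) (φ-rest x xi≢u xi≢v) (φ-∈Guv x∈G) , w-fresh (coord∈Gᵢ x∈G)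
    to-G : ∀ {y} → y ∈ domHat → (VGuv G ∩ ∁ (At w)) y → y ∈ domΓ × ((VS G ∩ ∁ (At u)) ∩ ∁ (At v)) y
    to-G {y} _ (y∈Guv , yi≢w) with satisfied y∈Guv
    ... | x , x∈G , φx≡y with classify (coord∈Gᵢ x∈G)
    ...   | inj₁ xi≡u = ⊥-elim (yi≢w (subst (At w) (trans (sym (φ-u x xi≡u)) φx≡y) (lookup-at x w)))
    ...   | inj₂ (inj₁ xi≡v) = ⊥-elim (yi≢w (subst (At w) (trans (sym (φ-v x xi≡v)) φx≡y) (lookup-at x w)))
    ...   | inj₂ (inj₂ (_ , xi≢u , xi≢v)) =
      subst (λ z → z ∈ domΓ × ((VS G ∩ ∁ (At u)) ∩ ∁ (At v)) z) (trans (sym (φ-rest x xi≢u xi≢v)) φx≡y)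
            (∈Γ x∈G , (x∈G , xi≢u) , xi≢v)

  Both : Pred (Tuple m) 0ℓ
  Both y = At w y × VS G (y [ u ]) × VS G (y [ v ])

  both? : Decidable Both
  both? = at? w ∩? (λ y → VS? G (y [ u ])) ∩? (λ y → VS? G (y [ v ]))

  lift-∈Guv : ∀ {a y} → contract a ≡ w → Lift a y → VGuv G y
  lift-∈Guv {a} {y} a↦w (yi≡w , ya∈G) = subst (VGuv G) φ[ya]≡y (φ-∈Guv ya∈G)
    where
    φ[ya]≡y : φ (y [ a ]) ≡ y
    φ[ya]≡y = trans (cong ((y [ a ]) [_]) (trans (cong contract (lookup-at y a)) a↦w))
                    (replace-restore y a yi≡w)

  Guv-over-w : ∀ {y} → VGuv G y → At w y → Lift u y ⊎ Lift v y
  Guv-over-w {y} y∈Guv yi≡w with satisfied y∈Guv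
  ... | x , x∈G , φx≡y with classify (coord∈Gᵢ x∈G)
  ...   | inj₁ xi≡u = inj₁ (yi≡w , subst (VS G) (replace-back xi≡u (trans (sym (φ-u x xi≡u)) φx≡y)) x∈G)
  ...   | inj₂ (inj₁ xi≡v) = inj₂ (yi≡w , subst (VS G) (replace-back xi≡v (trans (sym (φ-v x xi≡v)) φx≡y)) x∈G)
  ...   | inj₂ (inj₂ (_ , xi≢u , xi≢v)) = ⊥-elim (w-fresh (coord∈Gᵢ x∈G)
    (trans (cong (λ z → lookup z i) (trans (sym (φ-rest x xi≢u xi≢v)) φx≡y)) yi≡w))

  |lift-u|+|lift-v| : count (lift? u) domHat + count (lift? v) domHat
                    ≡ count (VGuv? G ∩? at? w) domHat + count both? domHat
  |lift-u|+|lift-v| = count-union (lift? u) (lift? v) (VGuv? G ∩? at? w) both?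
    (λ (y∈Guv , yi≡w) → Guv-over-w y∈Guv yi≡w)
    (λ lift → lift-∈Guv (contract-u refl) lift , proj₁ lift)
    (λ lift → lift-∈Guv (contract-v refl) lift , proj₁ lift)
    (λ (yi≡w , yu∈G , yv∈G) → (yi≡w , yu∈G) , (yi≡w , yv∈G))
    (λ (yi≡w , yu∈G) (_ , yv∈G) → yi≡w , yu∈G , yv∈G)
    domHat

  -- Both is exactly the centre part G^uv_c, read in Γ̂ instead of Γ̃.
  |both|≡|Gc| : count both? domHat ≡ |V[Gc]| G
  |both|≡|Gc| = count-bijection both? (VGc? G) domHat domTil id id Γ̂-unique Γ̃-unique
    to-Gc (λ _ _ _ _ → id) to-both (λ _ _ _ _ → id)
    where
    to-Gc : ∀ {y} → y ∈ domHat → Both y → y ∈ domTil × VGc G y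
    to-Gc y∈Γ̂ b@(yi≡w , _) = change-domain Vhat Vtil y∈Γ̂ (subst (_∈ Vtil) (sym yi≡w) (here refl)) ,
                             inj₁ b , yi≡w
    to-both : ∀ {y} → y ∈ domTil → VGc G y → y ∈ domHat × Both y
    to-both y∈Γ̃ (inj₁ b@(yi≡w , _) , _) =
      change-domain Vtil Vhat y∈Γ̃ (subst (_∈ Vhat) (sym yi≡w) (here refl)) , b
    to-both y∈Γ̃ (inj₂ (nb , _) , yi≡w) = ⊥-elim (w-fresh (proj₁ nb) yi≡w)

  -- |V(G)| = |V(G_uv)| + |V(G^uv_c)|: sort the vertices of G by their
  -- i-th coordinate (u, v or neither) and compare with G_uv over w and off w.
  vertex-count : |V[G]| G ≡ |V[Guv]| G + |V[Gc]| G
  vertex-count = begin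
    |V[G]| G
      ≡⟨ count-by (VS? G) (at? u) domΓ ⟩
    count (VS? G ∩? at? u) domΓ + count (VS? G ∩? ∁? (at? u)) domΓ
      ≡⟨ cong (count (VS? G ∩? at? u) domΓ +_) (count-by (VS? G ∩? ∁? (at? u)) (at? v) domΓ) ⟩
    |u| + (count ((VS? G ∩? ∁? (at? u)) ∩? at? v) domΓ + |off-uv|)
      ≡⟨ cong₂ (λ a b → a + (b + |off-uv|)) (|over|≡|lift| (VS? G ∩? at? u) u id id)
               (|over|≡|lift| ((VS? G ∩? ∁? (at? u)) ∩? at? v) v
                  (λ (x∈G , xi≡v) → (x∈G , λ xi≡u → u≢v (trans (sym xi≡u) xi≡v)) , xi≡v)
                  (λ ((x∈G , _) , xi≡v) → x∈G , xi≡v)) ⟩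
    count (lift? u) domHat + (count (lift? v) domHat + |off-uv|)
      ≡⟨ +-assoc (count (lift? u) domHat) _ _ ⟨
    (count (lift? u) domHat + count (lift? v) domHat) + |off-uv|
      ≡⟨ cong₂ _+_ |lift-u|+|lift-v| |off-uv|≡|Guv-off-w| ⟩
    (|Guv-at-w| + count both? domHat) + count (VGuv? G ∩? ∁? (at? w)) domHat
      ≡⟨ xy∙z≈xz∙y |Guv-at-w| (count both? domHat) _ ⟩
    (|Guv-at-w| + count (VGuv? G ∩? ∁? (at? w)) domHat) + count both? domHat
      ≡⟨ cong₂ _+_ (sym (count-by (VGuv? G) (at? w) domHat)) |both|≡|Gc| ⟩
    |V[Guv]| G + |V[Gc]| G ∎
    where
    open ≡-Reasoning
    |u| = count (VS? G ∩? at? u) domΓ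
    |off-uv| = count ((VS? G ∩? ∁? (at? u)) ∩? ∁? (at? v)) domΓ
    |Guv-at-w| = count (VGuv? G ∩? at? w) domHat

  along-i : ∀ {B x y} → Agree x y → B (lookup x i) (lookup y i) → ProdAdj (Repl B) x y
  along-i x≈y b = i , inj₁ (refl , b) , x≈y

  along-off : ∀ {B x y x′ y′} → ES G x y → lookup x i ≡ lookup y i →
              Agree x′ x → Agree y′ y → lookup x′ i ≡ lookup y′ i → ProdAdj (Repl B) x′ y′
  along-off {x = x} {y} {x′} {y′} es xi≡yi x′≈x y′≈y x′i≡y′i
    with edge-off (Adj-irr Gi) {x} {y} (ES-Γ G es) xi≡yi
  ... | j , j≢i , a , same =
    j , inj₂ (j≢i , subst₂ (Adj (Gs j)) (sym (x′≈x j j≢i)) (sym (y′≈y j j≢i)) a) , same′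
    where
    same′ : ∀ k → k ≢ j → lookup x′ k ≡ lookup y′ k
    same′ k k≢j with k ≟F i
    ... | yes refl = x′i≡y′i
    ... | no k≢i   = trans (x′≈x k k≢i) (trans (same k k≢j) (sym (y′≈y k k≢i)))

  repl-sym : ∀ {B} → (∀ {a b} → B a b → B b a) → ∀ j {a b} → Repl B j a b → Repl B j b a
  repl-sym sym-B j (inj₁ (j≡i , b)) = inj₁ (j≡i , sym-B b)
  repl-sym sym-B j (inj₂ (j≢i , a)) = inj₂ (j≢i , Adj-sym (Gs j) a)

  repl-irr : ∀ {B} → (∀ {a} → ¬ B a a) → ∀ j {a} → ¬ Repl B j a a
  repl-irr irr-B j (inj₁ (_ , b)) = irr-B b
  repl-irr irr-B j (inj₂ (_ , a)) = Adj-irr (Gs j) a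

  hat-sym : ∀ {a b} → AdjHat a b → AdjHat b a
  hat-sym (inj₁ centre-leaf)              = inj₂ (inj₁ centre-leaf)
  hat-sym (inj₂ (inj₁ leaf-centre))       = inj₁ leaf-centre
  hat-sym (inj₂ (inj₂ (ra , rb , a)))     = inj₂ (inj₂ (rb , ra , Adj-sym Gi a))

  hat-irr : ∀ {a} → ¬ AdjHat a a
  hat-irr (inj₁ (a≡w , ra , _))        = w-fresh (proj₁ ra) a≡w
  hat-irr (inj₂ (inj₁ (a≡w , ra , _))) = w-fresh (proj₁ ra) a≡w
  hat-irr (inj₂ (inj₂ (_ , _ , a)))    = Adj-irr Gi a

  til-sym : ∀ {a b} → AdjTil a b → AdjTil b a
  til-sym (inj₁ centre-leaf) = inj₂ centre-leaf
  til-sym (inj₂ leaf-centre) = inj₁ leaf-centre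

  til-irr : ∀ {a} → ¬ AdjTil a a
  til-irr (inj₁ (a≡w , nb)) = w-fresh (proj₁ nb) a≡w
  til-irr (inj₂ (a≡w , nb)) = w-fresh (proj₁ nb) a≡w

  contract-adjacent : ∀ {a b} → a ∈ V Gi → b ∈ V Gi → Adj Gi a b →
    ¬ (a ≡ u × b ≡ v) → ¬ (a ≡ v × b ≡ u) → AdjHat (contract a) (contract b)
  contract-adjacent a∈ b∈ ab ¬uv ¬vu with classify a∈ | classify b∈
  ... | inj₁ refl        | inj₁ refl        = ⊥-elim (Adj-irr Gi ab)
  ... | inj₁ refl        | inj₂ (inj₁ refl) = ⊥-elim (¬uv (refl , refl))
  ... | inj₂ (inj₁ refl) | inj₁ refl        = ⊥-elim (¬vu (refl , refl))
  ... | inj₂ (inj₁ refl) | inj₂ (inj₁ refl) = ⊥-elim (Adj-irr Gi ab)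
  ... | inj₁ refl        | inj₂ (inj₂ rb@(_ , b≢u , b≢v)) =
    subst₂ AdjHat (sym (contract-u refl)) (sym (contract-rest b≢u b≢v)) (inj₁ (refl , rb , inj₁ ab))
  ... | inj₂ (inj₁ refl) | inj₂ (inj₂ rb@(_ , b≢u , b≢v)) =
    subst₂ AdjHat (sym (contract-v refl)) (sym (contract-rest b≢u b≢v)) (inj₁ (refl , rb , inj₂ ab))
  ... | inj₂ (inj₂ ra@(_ , a≢u , a≢v)) | inj₁ refl =
    subst₂ AdjHat (sym (contract-rest a≢u a≢v)) (sym (contract-u refl)) (inj₂ (inj₁ (refl , ra , inj₁ (Adj-sym Gi ab))))
  ... | inj₂ (inj₂ ra@(_ , a≢u , a≢v)) | inj₂ (inj₁ refl) =
    subst₂ AdjHat (sym (contract-rest a≢u a≢v)) (sym (contract-v refl)) (inj₂ (inj₁ (refl , ra , inj₂ (Adj-sym Gi ab))))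
  ... | inj₂ (inj₂ ra@(_ , a≢u , a≢v)) | inj₂ (inj₂ rb@(_ , b≢u , b≢v)) =
    subst₂ AdjHat (sym (contract-rest a≢u a≢v)) (sym (contract-rest b≢u b≢v)) (inj₂ (inj₂ (ra , rb , ab)))

  Pair : Set
  Pair = Tuple m × Tuple m

  Edge : Pred Pair 0ℓ
  Edge (x , y) = ES G x y

  edge? : Decidable Edge
  edge? (x , y) = ES? G x y

  Cross : ℕ → ℕ → Pred Pair 0ℓ
  Cross a b (x , y) = At a x × At b y

  cross? : ∀ a b → Decidable (Cross a b)
  cross? a b (x , y) = at? a x ×-dec at? b y

  Inner : Pred Pair 0ℓ
  Inner = (Edge ∩ ∁ (Cross u v)) ∩ ∁ (Cross v u)

  inner? : Decidable Inner
  inner? = (edge? ∩? ∁? (cross? u v)) ∩? ∁? (cross? v u)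

  φ-edge : ∀ {x y} → Inner (x , y) → ProdAdj (Repl AdjHat) (φ x) (φ y)
  φ-edge {x} {y} ((es , ¬uv) , ¬vu) with lookup x i ≟ lookup y i
  ... | yes xi≡yi = along-off {AdjHat} {x} {y} {φ x} {φ y} es xi≡yi (λ k → φ-off x) (λ k → φ-off y)
                      (trans (φ-at x) (trans (cong contract xi≡yi) (sym (φ-at y))))
  ... | no xi≢yi with edge-at {x} {y} (ES-Γ G es) xi≢yi
  ...   | x≈y , xi~yi = along-i {AdjHat} {φ x} {φ y}
    (λ k k≢i → trans (φ-off x k≢i) (trans (x≈y k k≢i) (sym (φ-off y k≢i))))
    (subst₂ AdjHat (sym (φ-at x)) (sym (φ-at y))
      (contract-adjacent (coord∈Gᵢ x∈G) (coord∈Gᵢ y∈G) xi~yi ¬uv ¬vu))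
    where
    x∈G = proj₁ (ES-V G es)
    y∈G = proj₂ (ES-V G es)

  Twin : Tuple m → Tuple m → Set
  Twin x x′ = At v x × x′ ≡ x [ u ]

  contract-rest≢w : ∀ {a} → Rest a → contract a ≢ w
  contract-rest≢w (a∈Gᵢ , a≢u , a≢v) a≡w = w-fresh a∈Gᵢ (trans (sym (contract-rest a≢u a≢v)) a≡w)

  φ-collision : ∀ {x x′} → VS G x → VS G x′ → φ x ≡ φ x′ → x ≡ x′ ⊎ Twin x x′ ⊎ Twin x′ x
  φ-collision {x} {x′} x∈G x′∈G φx≡φx′ =
    by-position (classify (coord∈Gᵢ x∈G)) (classify (coord∈Gᵢ x′∈G))
    where
    x≈x′ : Agree x x′
    x≈x′ k k≢i = trans (sym (φ-off x k≢i)) (trans (cong (λ z → lookup z k) φx≡φx′) (φ-off x′ k≢i))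
    level : contract (lookup x i) ≡ contract (lookup x′ i)
    level = trans (sym (φ-at x)) (trans (cong (λ z → lookup z i) φx≡φx′) (φ-at x′))
    by-position : lookup x i ≡ u ⊎ lookup x i ≡ v ⊎ Rest (lookup x i) →
                  lookup x′ i ≡ u ⊎ lookup x′ i ≡ v ⊎ Rest (lookup x′ i) →
                  x ≡ x′ ⊎ Twin x x′ ⊎ Twin x′ x
    by-position (inj₁ xi≡u)        (inj₁ x′i≡u)        = inj₁ (agree-≡ x≈x′ (trans xi≡u (sym x′i≡u)))
    by-position (inj₂ (inj₁ xi≡v)) (inj₂ (inj₁ x′i≡v)) = inj₁ (agree-≡ x≈x′ (trans xi≡v (sym x′i≡v)))
    by-position (inj₂ (inj₁ xi≡v)) (inj₁ x′i≡u)        = inj₂ (inj₁ (xi≡v , agree-at x≈x′ x′i≡u))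
    by-position (inj₁ xi≡u)        (inj₂ (inj₁ x′i≡v)) = inj₂ (inj₂ (x′i≡v , agree-at (agree-sym {x} {x′} x≈x′) xi≡u))
    by-position (inj₂ (inj₂ r)) (inj₁ x′i≡u)        = ⊥-elim (contract-rest≢w r (trans level (contract-u x′i≡u)))
    by-position (inj₂ (inj₂ r)) (inj₂ (inj₁ x′i≡v)) = ⊥-elim (contract-rest≢w r (trans level (contract-v x′i≡v)))
    by-position (inj₁ xi≡u)        (inj₂ (inj₂ r′)) = ⊥-elim (contract-rest≢w r′ (trans (sym level) (contract-u xi≡u)))
    by-position (inj₂ (inj₁ xi≡v)) (inj₂ (inj₂ r′)) = ⊥-elim (contract-rest≢w r′ (trans (sym level) (contract-v xi≡v)))
    by-position (inj₂ (inj₂ (_ , xi≢u , xi≢v))) (inj₂ (inj₂ (_ , x′i≢u , x′i≢v))) =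
      inj₁ (agree-≡ x≈x′ (trans (sym (contract-rest xi≢u xi≢v)) (trans level (contract-rest x′i≢u x′i≢v))))

  ToStar : Pred Pair 0ℓ
  ToStar (x , y) = (At v x × At v y × ES G (x [ u ]) (y [ u ]))
                 ⊎ (At v x × ¬ At v y × ES G (x [ u ]) y)
                 ⊎ (¬ At v x × At v y × ES G x (y [ u ]))

  to-star? : Decidable ToStar
  to-star? (x , y) = (at? v x ×-dec at? v y ×-dec ES? G (x [ u ]) (y [ u ]))
                ⊎-dec (at? v x ×-dec ¬? (at? v y) ×-dec ES? G (x [ u ]) y)
                ⊎-dec (¬? (at? v x) ×-dec at? v y ×-dec ES? G x (y [ u ]))

  -- Two inner edges with the same φ-image, one of them through a twin, force
  -- one of them to be handed over to G^uv.
  twin-left : ∀ {x y x′ y′} → Inner (x′ , y′) → Twin x x′ → y ≡ y′ ⊎ Twin y y′ → ToStar (x , y)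
  twin-left {x} {y} ((es′ , ¬uv′) , _) (xi≡v , refl) (inj₁ refl) with at? v y
  ... | yes yi≡v = ⊥-elim (¬uv′ (lookup-at x u , yi≡v))
  ... | no yi≢v  = inj₂ (inj₁ (xi≡v , yi≢v , es′))
  twin-left ((es′ , _) , _) (xi≡v , refl) (inj₂ (yi≡v , refl)) = inj₁ (xi≡v , yi≡v , es′)

  twin-right : ∀ {x y y′} → Inner (x , y′) → Twin y y′ → ToStar (x , y)
  twin-right {x} {y} ((es′ , _) , ¬vu′) (yi≡v , refl) with at? v x
  ... | yes xi≡v = ⊥-elim (¬vu′ (xi≡v , lookup-at y u))
  ... | no xi≢v  = inj₂ (inj₂ (xi≢v , yi≡v , es′))

  crossed-twins : ∀ {x y x′ y′} → Inner (x , y) → Twin x x′ → Twin y′ y → ⊥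
  crossed-twins {y′ = y′} (_ , ¬vu) (xi≡v , _) (_ , refl) = ¬vu (xi≡v , lookup-at y′ u)

  same-image : ∀ {x y x′ y′} → Inner (x , y) → ¬ ToStar (x , y) → Inner (x′ , y′) → ¬ ToStar (x′ , y′) →
               x ≡ x′ ⊎ Twin x x′ ⊎ Twin x′ x → y ≡ y′ ⊎ Twin y y′ ⊎ Twin y′ y → (x , y) ≡ (x′ , y′)
  same-image _ _ _ _ (inj₁ refl) (inj₁ refl) = refl
  same-image _ ¬s e′ _ (inj₁ refl) (inj₂ (inj₁ t)) = ⊥-elim (¬s (twin-right e′ t))
  same-image e _ _ ¬s′ (inj₁ refl) (inj₂ (inj₂ t)) = ⊥-elim (¬s′ (twin-right e t))
  same-image _ ¬s e′ _ (inj₂ (inj₁ t)) (inj₁ y≡y′) = ⊥-elim (¬s (twin-left e′ t (inj₁ y≡y′)))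
  same-image _ ¬s e′ _ (inj₂ (inj₁ t)) (inj₂ (inj₁ t′)) = ⊥-elim (¬s (twin-left e′ t (inj₂ t′)))
  same-image e _ _ _ (inj₂ (inj₁ t)) (inj₂ (inj₂ t′)) = ⊥-elim (crossed-twins e t t′)
  same-image e _ _ ¬s′ (inj₂ (inj₂ t)) (inj₁ y≡y′) = ⊥-elim (¬s′ (twin-left e t (inj₁ (sym y≡y′))))
  same-image _ _ e′ _ (inj₂ (inj₂ t)) (inj₂ (inj₁ t′)) = ⊥-elim (crossed-twins e′ t t′)
  same-image e _ _ ¬s′ (inj₂ (inj₂ t)) (inj₂ (inj₂ t′)) = ⊥-elim (¬s′ (twin-left e t (inj₂ t′)))

  ordered-pairs : List Pair
  ordered-pairs = cartesianProduct domΓ domΓ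

  ordered-pairs-unique : Unique ordered-pairs
  ordered-pairs-unique = cartesianProduct⁺ Γ-unique Γ-unique

  ends∈G : ∀ {p} → Inner p → VS G (proj₁ p) × VS G (proj₂ p)
  ends∈G ((es , _) , _) = ES-V G es

  module Ĝ = OrderedPairs (EGuv? G)
  module G̃ = OrderedPairs (EGup? G)

  |staying|≤|Guv| : count (inner? ∩? ∁? to-star?) ordered-pairs ≤ Ĝ.pairs domHat domHat
  |staying|≤|Guv| = count-injection (inner? ∩? ∁? to-star?) Ĝ.Related? ordered-pairs
    (cartesianProduct domHat domHat) (λ (x , y) → φ x , φ y) ordered-pairs-unique into injective
    where
    into : ∀ {p} → p ∈ ordered-pairs → (Inner ∩ ∁ ToStar) p →
           (φ (proj₁ p) , φ (proj₂ p)) ∈ cartesianProduct domHat domHat × Ĝ.Related (φ (proj₁ p) , φ (proj₂ p))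
    into _ (e , _) with ends∈G e
    ... | x∈G , y∈G = ∈-cartesianProduct⁺ (φ-∈Γ̂ x∈G) (φ-∈Γ̂ y∈G) , φ-∈Guv x∈G , φ-∈Guv y∈G , φ-edge e
    injective : ∀ {p q} → p ∈ ordered-pairs → q ∈ ordered-pairs → (Inner ∩ ∁ ToStar) p → (Inner ∩ ∁ ToStar) q →
                (φ (proj₁ p) , φ (proj₂ p)) ≡ (φ (proj₁ q) , φ (proj₂ q)) → p ≡ q
    injective _ _ (e , ¬s) (e′ , ¬s′) images≡ = same-image e ¬s e′ ¬s′
      (φ-collision (proj₁ (ends∈G e)) (proj₁ (ends∈G e′)) (cong proj₁ images≡))
      (φ-collision (proj₂ (ends∈G e)) (proj₂ (ends∈G e′)) (cong proj₂ images≡))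

  centre-v : ℕ → ℕ
  centre-v a = if does (a ≟ v) then w else a

  ψ : Tuple m → Tuple m
  ψ x = x [ centre-v (lookup x i) ]

  ψ-v : ∀ x → At v x → ψ x ≡ x [ w ]
  ψ-v x xi≡v rewrite dec-true (lookup x i ≟ v) xi≡v = refl

  ψ-rest : ∀ x → ¬ At v x → ψ x ≡ x
  ψ-rest x xi≢v rewrite dec-false (lookup x i ≟ v) xi≢v = replace-self x refl

  -- ψ is injective on vertices of G, since w̃ is new.
  ψ-injective : ∀ {x x′} → VS G x → VS G x′ → ψ x ≡ ψ x′ → x ≡ x′
  ψ-injective {x} {x′} x∈G x′∈G ψx≡ψx′ with at? v x | at? v x′
  ... | yes xi≡v | yes x′i≡v = replace-injective xi≡v x′i≡v (trans (sym (ψ-v x xi≡v)) (trans ψx≡ψx′ (ψ-v x′ x′i≡v)))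
  ... | yes xi≡v | no x′i≢v  = ⊥-elim (w-fresh (coord∈Gᵢ x′∈G)
    (trans (cong (λ z → lookup z i) (trans (sym (ψ-rest x′ x′i≢v)) (trans (sym ψx≡ψx′) (ψ-v x xi≡v)))) (lookup-at x w)))
  ... | no xi≢v  | yes x′i≡v = ⊥-elim (w-fresh (coord∈Gᵢ x∈G)
    (trans (cong (λ z → lookup z i) (trans (sym (ψ-rest x xi≢v)) (trans ψx≡ψx′ (ψ-v x′ x′i≡v)))) (lookup-at x′ w)))
  ... | no xi≢v  | no x′i≢v  = trans (sym (ψ-rest x xi≢v)) (trans ψx≡ψx′ (ψ-rest x′ x′i≢v))

  centre-∈Gup : ∀ x → VS G (x [ u ]) → VS G (x [ v ]) → VGup G (x [ w ])
  centre-∈Gup x xu∈G xv∈G = inj₁ (lookup-at x w ,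
    subst (VS G) (sym (replace-replace x w u)) xu∈G , subst (VS G) (sym (replace-replace x w v)) xv∈G)

  leaf-∈Gup : ∀ y → Nb (lookup y i) → VS G y → VS G (y [ u ]) → VS G (y [ v ]) → VGup G y
  leaf-∈Gup y nb y∈G yu∈G yv∈G = inj₂ (nb , subst (VS G) (sym (replace-self y refl)) y∈G , yu∈G , yv∈G)

  StarEdge : Tuple m → Tuple m → Set
  StarEdge x y = x ∈ domTil × y ∈ domTil × EGup G x y

  star-edge-sym : ∀ {x y} → StarEdge x y → StarEdge y x
  star-edge-sym {x} {y} (x∈ , y∈ , x∈Gup , y∈Gup , xy) =
    y∈ , x∈ , y∈Gup , x∈Gup , prodAdj-sym (repl-sym {AdjTil} til-sym) {x} {y} xy

  star-centres : ∀ {x y} → ES G x y → At v x → At v y → ES G (x [ u ]) (y [ u ]) →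
                 StarEdge (x [ w ]) (y [ w ])
  star-centres {x} {y} es xi≡v yi≡v esᵤ =
    replace-∈-domain Vtil (VS-Γ G x∈G) (here refl) , replace-∈-domain Vtil (VS-Γ G y∈G) (here refl) ,
    centre-∈Gup x (proj₁ (ES-V G esᵤ)) (subst (VS G) (sym (replace-self x xi≡v)) x∈G) ,
    centre-∈Gup y (proj₂ (ES-V G esᵤ)) (subst (VS G) (sym (replace-self y yi≡v)) y∈G) ,
    along-off {AdjTil} {x} {y} {x [ w ]} {y [ w ]} es (trans xi≡v (sym yi≡v))
      (agree-replaced x w) (agree-replaced y w) (trans (lookup-at x w) (sym (lookup-at y w)))
    where
    x∈G = proj₁ (ES-V G es)
    y∈G = proj₂ (ES-V G es)

  -- An edge of G from x over v to y over a vertex other than u and v, where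
  -- also x[u] ~ y, joins the centre x[w̃] to the leaf y of G^uv: the i-th
  -- coordinate of y is a common neighbour of u and v.
  star-leaf : ∀ {x y} → ES G x y → At v x → ¬ At v y → ¬ At u y → ES G (x [ u ]) y →
              StarEdge (x [ w ]) y
  star-leaf {x} {y} es xi≡v yi≢v yi≢u esᵤ with edge-at {x} {y} (ES-Γ G es) (λ xi≡yi → yi≢v (trans (sym xi≡yi) xi≡v))
                                            | edge-at {x [ u ]} {y} (ES-Γ G esᵤ) (λ e → yi≢u (trans (sym e) (lookup-at x u)))
  ... | x≈y , v~yi | _ , u~yi =
    replace-∈-domain Vtil (VS-Γ G x∈G) (here refl) , ∈-domain Vtil (nb∈G̃ᵢ nb) (λ j _ → VS-Γ G y∈G j) ,
    centre-∈Gup x (proj₁ (ES-V G esᵤ)) (subst (VS G) (sym (replace-self x xi≡v)) x∈G) ,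
    leaf-∈Gup y nb y∈G (subst (VS G) (agree-replace x≈y u) (proj₁ (ES-V G esᵤ)))
                       (subst (VS G) (trans (sym (replace-self x xi≡v)) (agree-replace x≈y v)) x∈G) ,
    along-i {AdjTil} {x [ w ]} {y} (λ k k≢i → trans (lookup-off x w k≢i) (x≈y k k≢i))
      (subst (λ a → AdjTil a (lookup y i)) (sym (lookup-at x w)) (inj₁ (refl , nb)))
    where
    x∈G = proj₁ (ES-V G es)
    y∈G = proj₂ (ES-V G es)
    nb : Nb (lookup y i)
    nb = coord∈Gᵢ y∈G , subst (λ a → Adj Gi a (lookup y i)) (lookup-at x u) u~yi
                      , subst (λ a → Adj Gi a (lookup y i)) xi≡v v~yi

  ψ-edge : ∀ {x y} → Inner (x , y) → ToStar (x , y) → StarEdge (ψ x) (ψ y)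
  ψ-edge {x} {y} ((es , _) , _) (inj₁ (xi≡v , yi≡v , esᵤ))
    rewrite ψ-v x xi≡v | ψ-v y yi≡v = star-centres es xi≡v yi≡v esᵤ
  ψ-edge {x} {y} ((es , _) , ¬vu) (inj₂ (inj₁ (xi≡v , yi≢v , esᵤ)))
    rewrite ψ-v x xi≡v | ψ-rest y yi≢v = star-leaf es xi≡v yi≢v (λ yi≡u → ¬vu (xi≡v , yi≡u)) esᵤ
  ψ-edge {x} {y} ((es , ¬uv) , _) (inj₂ (inj₂ (xi≢v , yi≡v , esᵤ)))
    rewrite ψ-rest x xi≢v | ψ-v y yi≡v = star-edge-sym
      (star-leaf (ES-sym G es) yi≡v xi≢v (λ xi≡u → ¬uv (xi≡u , yi≡v)) (ES-sym G esᵤ))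

  |handed-over|≤|Gup| : count (inner? ∩? to-star?) ordered-pairs ≤ G̃.pairs domTil domTil
  |handed-over|≤|Gup| = count-injection (inner? ∩? to-star?) G̃.Related? ordered-pairs
    (cartesianProduct domTil domTil) (λ (x , y) → ψ x , ψ y) ordered-pairs-unique into injective
    where
    into : ∀ {p} → p ∈ ordered-pairs → (Inner ∩ ToStar) p →
           (ψ (proj₁ p) , ψ (proj₂ p)) ∈ cartesianProduct domTil domTil × G̃.Related (ψ (proj₁ p) , ψ (proj₂ p))
    into _ (e , s) with ψ-edge e s
    ... | x∈ , y∈ , edge = ∈-cartesianProduct⁺ x∈ y∈ , edge
    injective : ∀ {p q} → p ∈ ordered-pairs → q ∈ ordered-pairs → (Inner ∩ ToStar) p → (Inner ∩ ToStar) q →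
                (ψ (proj₁ p) , ψ (proj₂ p)) ≡ (ψ (proj₁ q) , ψ (proj₂ q)) → p ≡ q
    injective _ _ (e , _) (e′ , _) images≡ =
      cong₂ _,_ (ψ-injective (proj₁ (ends∈G e)) (proj₁ (ends∈G e′)) (cong proj₁ images≡))
                (ψ-injective (proj₂ (ends∈G e)) (proj₂ (ends∈G e′)) (cong proj₂ images≡))

  -- An edge of G from the layer over a to the layer over b, where {a , b} is
  -- {u , v}, is determined by its start x; and x[w̃] lies in G^uv_c.
  |crossing|≤|Gc| : ∀ {P : Pred Pair 0ℓ} (P? : Decidable P) a b → a ≢ b →
    (∀ {z} → VS G (z [ a ]) → VS G (z [ b ]) → VS G (z [ u ]) × VS G (z [ v ])) →
    (∀ {p} → P p → Edge p × Cross a b p) →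
    count P? ordered-pairs ≤ |V[Gc]| G
  |crossing|≤|Gc| {P} P? a b a≢b orient crossing = count-injection P? (VGc? G) ordered-pairs domTil
    (λ (x , y) → x [ w ]) ordered-pairs-unique into injective
    where
    end : ∀ {x y} → P (x , y) → y ≡ x [ b ]
    end {x} {y} p with crossing p
    ... | es , xi≡a , yi≡b =
      agree-at (proj₁ (edge-at {x} {y} (ES-Γ G es) (λ xi≡yi → a≢b (trans (sym xi≡a) (trans xi≡yi yi≡b))))) yi≡b
    into : ∀ {p} → p ∈ ordered-pairs → P p → proj₁ p [ w ] ∈ domTil × VGc G (proj₁ p [ w ])
    into {x , y} _ p with crossing p
    ... | es , xi≡a , _ =
      replace-∈-domain Vtil (VS-Γ G x∈G) (here refl) ,
      centre-∈Gup x (proj₁ copies) (proj₂ copies) , lookup-at x w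
      where
      x∈G = proj₁ (ES-V G es)
      copies = orient (subst (VS G) (sym (replace-self x xi≡a)) x∈G)
                      (subst (VS G) (end p) (proj₂ (ES-V G es)))
    injective : ∀ {p q} → p ∈ ordered-pairs → q ∈ ordered-pairs → P p → P q →
                proj₁ p [ w ] ≡ proj₁ q [ w ] → p ≡ q
    injective {x , y} {x′ , y′} _ _ p q x[w]≡x′[w] = cong₂ _,_ x≡x′
      (trans (end p) (trans (cong (_[ b ]) x≡x′) (sym (end q))))
      where
      x≡x′ : x ≡ x′
      x≡x′ = replace-injective (proj₁ (proj₂ (crossing p))) (proj₁ (proj₂ (crossing q))) x[w]≡x′[w]

  -- Every ordered edge of G goes from u to v or from v to u (both counted by
  -- G^uv_c), is handed over to G^uv, or stays in G_uv.
  ordered-edges≤ : count edge? ordered-pairs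
                 ≤ Ĝ.pairs domHat domHat + G̃.pairs domTil domTil + (|V[Gc]| G + |V[Gc]| G)
  ordered-edges≤ = begin
    count edge? ordered-pairs
      ≡⟨ count-by edge? (cross? u v) ordered-pairs ⟩
    |u→v| + count (edge? ∩? ∁? (cross? u v)) ordered-pairs
      ≡⟨ cong (|u→v| +_) (count-by (edge? ∩? ∁? (cross? u v)) (cross? v u) ordered-pairs) ⟩
    |u→v| + (|v→u| + count inner? ordered-pairs)
      ≡⟨ cong (λ n → |u→v| + (|v→u| + n)) (count-by inner? to-star? ordered-pairs) ⟩
    |u→v| + (|v→u| + (count (inner? ∩? to-star?) ordered-pairs + count (inner? ∩? ∁? to-star?) ordered-pairs))
      ≤⟨ +-mono-≤ (|crossing|≤|Gc| (edge? ∩? cross? u v) u v u≢v (λ zu zv → zu , zv) id)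
                  (+-mono-≤ (|crossing|≤|Gc| ((edge? ∩? ∁? (cross? u v)) ∩? cross? v u) v u (u≢v ∘ sym)
                                              (λ zv zu → zu , zv) (λ ((es , _) , c) → es , c))
                            (+-mono-≤ |handed-over|≤|Gup| |staying|≤|Guv|)) ⟩
    d + (d + (G̃.pairs domTil domTil + Ĝ.pairs domHat domHat))
      ≡⟨ regroup d (G̃.pairs domTil domTil) (Ĝ.pairs domHat domHat) ⟩
    Ĝ.pairs domHat domHat + G̃.pairs domTil domTil + (d + d) ∎
    where
    open ≤-Reasoning
    d = |V[Gc]| G
    |u→v| = count (edge? ∩? cross? u v) ordered-pairs
    |v→u| = count ((edge? ∩? ∁? (cross? u v)) ∩? cross? v u) ordered-pairs
    regroup : ∀ d c b → d + (d + (c + b)) ≡ b + c + (d + d)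
    regroup = solve-∀

  edge-count : |E[G]| G ≤ |E[Guv]| G + |E[Gup]| G + |V[Gc]| G
  edge-count = half-≤ (|E[Guv]| G) (|E[Gup]| G) (|V[Gc]| G) (begin
    count edge? ordered-pairs
      ≤⟨ ordered-edges≤ ⟩
    Ĝ.pairs domHat domHat + G̃.pairs domTil domTil + (|V[Gc]| G + |V[Gc]| G)
      ≡⟨ cong₂ (λ b c → b + c + (|V[Gc]| G + |V[Gc]| G))
               (Ĝ.pairs≡edges+edges Guv-sym Guv-irr domHat) (G̃.pairs≡edges+edges Gup-sym Gup-irr domTil) ⟩
    (|E[Guv]| G + |E[Guv]| G) + (|E[Gup]| G + |E[Gup]| G) + (|V[Gc]| G + |V[Gc]| G) ∎)
    where
    open ≤-Reasoning
    Guv-sym : ∀ {y z} → EGuv G y z → EGuv G z y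
    Guv-sym {y} {z} (y∈ , z∈ , yz) = z∈ , y∈ , prodAdj-sym (repl-sym {AdjHat} hat-sym) {y} {z} yz
    Guv-irr : ∀ {y} → ¬ EGuv G y y
    Guv-irr {y} (_ , _ , yy) = prodAdj-irr {A = Repl AdjHat} (repl-irr {AdjHat} (λ {a} → hat-irr {a})) {y} yy
    Gup-sym : ∀ {y z} → EGup G y z → EGup G z y
    Gup-sym {y} {z} (y∈ , z∈ , yz) = z∈ , y∈ , prodAdj-sym (repl-sym {AdjTil} til-sym) {y} {z} yz
    Gup-irr : ∀ {y} → ¬ EGup G y y
    Gup-irr {y} (_ , _ , yy) = prodAdj-irr {A = Repl AdjTil} (repl-irr {AdjTil} (λ {a} → til-irr {a})) {y} yy

  Gup-split : |V[Gup]| G ≡ |V[Gc]| G + |Vl[Gup]| G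
  Gup-split = count-by (VGup? G) (at? w) domTil

  add-centre : |V[Guv]| G + |V[Gup]| G ∸ |Vl[Gup]| G ≡ |V[Guv]| G + |V[Gc]| G
  add-centre = begin
    |V[Guv]| G + |V[Gup]| G ∸ |Vl[Gup]| G
      ≡⟨ cong (λ n → |V[Guv]| G + n ∸ |Vl[Gup]| G) Gup-split ⟩
    |V[Guv]| G + (|V[Gc]| G + |Vl[Gup]| G) ∸ |Vl[Gup]| G
      ≡⟨ cong (_∸ |Vl[Gup]| G) (+-assoc (|V[Guv]| G) _ _) ⟨
    |V[Guv]| G + |V[Gc]| G + |Vl[Gup]| G ∸ |Vl[Gup]| G
      ≡⟨ m+n∸n≡m (|V[Guv]| G + |V[Gc]| G) (|Vl[Gup]| G) ⟩
    |V[Guv]| G + |V[Gc]| G ∎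
    where open ≡-Reasoning

lemma6p6 : {m : ℕ} (Gs : Fin m → Graph) → (∀ j → Connected (Gs j)) →
           (G : Product.Subgraph Gs) (i : Fin m) (u v : ℕ) → Adj (Gs i) u v →
           let open Constructions Gs i u v in
           (|V[G]| G ≡ |V[Guv]| G + |V[Gup]| G ∸ |Vl[Gup]| G)
           × (|V[Guv]| G + |V[Gup]| G ∸ |Vl[Gup]| G ≡ |V[Guv]| G + |V[Gc]| G)
           × (|E[G]| G ≤ |E[Guv]| G + |E[Gup]| G + |V[Gc]| G)
lemma6p6 Gs _ G i u v uv =
  trans vertex-count (sym add-centre) , add-centre , edge-count
  where open Decomposition Gs G i u v uv
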